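{- Let $(S,*)$ be an adequate partial semigroup, let $n\in\mathbb{N}$, and let $f(1),\dots,f(n)$ be elements of $S$ such that for every nonempty $H\subseteq\{1,\dots,n\}$, $\prod_{t\in H}f(t)$ is defined. If $\mathcal{T}\neq\emptyset$, then $f$ can be extended to an adequate sequence $\langle f(t)\rangle_{t=1}^\infty$.
   Context: A partial semigroup is a pair $(S,*)$ where $S$ is a nonempty set and $*$ is an operation defined on a nonempty subset of $S\times S$ such that for all $x,y,z\in S$, $(x*y)*z=x*(y*z)$ in the sense that if either side is defined then so is the other and they are equal. For $a\in S$, $\varphi(a)=\{b\in S: a*b \text{ is defined}\}$; for finite nonempty $F\subseteq S$, $\sigma(F)=\bigcap_{a\in F}\varphi(a)$. $(S,*)$ is adequate if $\sigma(F)\neq\emptyset$ for all finite nonempty $F$. $\mathcal{P}_f(X)$ denotes the set of finite nonempty subsets of $X$. Products $\prod_{t\in H}f(t)$ are computed in increasing order of indices. A sequence $f:\mathbb{N}\to S$ is adequate if (i) for each $H\in\mathcal{P}_f(\mathbb{N})$, $\prod_{t\in H}f(t)$ is defined, and (ii) for each $F\in\mathcal{P}_f(S)$ there is $m\in\mathbb{N}$ such that $\prod_{t\in H}f(t)\in\sigma(F)$ for all $H\in\mathcal{P}_f(\mathbb{N})$ with $\min H\geq m$. $\mathcal{T}$ denotes the set of adequate sequences in $S$. -}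

module Defs where

open import Data.Nat using (ℕ; _≤_; _<_)
open import Data.Fin using (Fin; toℕ)
import Data.Fin as Fin
open import Data.Maybe using (Maybe; just; nothing; Is-just)
open import Data.List using (List; []; _∷_)
open import Data.List.NonEmpty using (List⁺; _∷_; toList; head)
open import Data.List.Relation.Unary.All using (All)
open import Data.List.Relation.Unary.Linked using (Linked)
open import Data.Product using (Σ; ∃; ∃-syntax; _×_)
open import Relation.Binary.PropositionalEquality using (_≡_)

lift : {S : Set} → (S → S → Maybe S) → Maybe S → Maybe S → Maybe S
lift op (just x) (just y) = op x y
lift op (just x) nothing = nothing
lift op nothing _ = nothing

record PartialSemigroup : Set₁ where
  field
    Carrier : Set
    _·_     : Carrier → Carrier → Maybe Carrier
    -- (x*y)*z = x*(y*z): one side defined iff the other is, and then equal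
    assoc : ∀ x y z → lift _·_ (lift _·_ (just x) (just y)) (just z) ≡ lift _·_ (just x) (lift _·_ (just y) (just z))
    domain-nonempty : ∃[ x ] ∃[ y ] Is-just (x · y)

module _ (PS : PartialSemigroup) where
  open PartialSemigroup PS

  _⋆_ : Maybe Carrier → Maybe Carrier → Maybe Carrier
  _⋆_ = lift _·_

  φ : Carrier → Carrier → Set
  φ a b = Is-just (a · b)

  σ : List⁺ Carrier → Carrier → Set
  σ F b = All (λ a → φ a b) (toList F)

  Adequate : Set
  Adequate = ∀ (F : List⁺ Carrier) → ∃[ b ] σ F b

  prodL : {A : Set} → (A → Carrier) → A → List A → Maybe Carrier
  prodL f x [] = just (f x)
  prodL f x (y ∷ ys) = just (f x) ⋆ prodL f y ys

  -- ∏_{t ∈ H} f(t), where the finite nonempty set H is given as a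
  -- strictly increasing nonempty list (so the product is in increasing order)
  prod : {A : Set} → (A → Carrier) → List⁺ A → Maybe Carrier
  prod f (x ∷ xs) = prodL f x xs

  IncreasingFinSet : List⁺ ℕ → Set
  IncreasingFinSet H = Linked _<_ (toList H)

  -- adequate sequence (min H = head H for increasing H)
  AdequateSeq : (ℕ → Carrier) → Set
  AdequateSeq g =
    (∀ (H : List⁺ ℕ) → IncreasingFinSet H → Is-just (prod g H))
    × (∀ (F : List⁺ Carrier) → ∃[ m ] (∀ (H : List⁺ ℕ) → IncreasingFinSet H → m ≤ head H →
         ∃[ s ] (prod g H ≡ just s × σ F s)))

  𝒯-nonempty : Set
  𝒯-nonempty = ∃[ g ] AdequateSeq g

-- Take any adequate sequence h and let F consist of all defined products of f. Adequacy of h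
-- gives m such that every product of h over indices ≥ m is defined and lies in σ(F). Put
-- g = f(0), …, f(n−1), h(m), h(m+1), … . A product of g over H splits into a product of f
-- (defined by hypothesis, and a member of F) followed by a product of h over indices ≥ m
-- (a member of σ(F)), so it is defined; condition (ii) for g is inherited from h with every
-- threshold raised by n.

module Submission where

open import Defs
open import Data.Nat using (ℕ)
open import Data.Fin using (Fin; toℕ)
import Data.Fin as Fin
open import Data.Maybe using (Is-just)
open import Data.List.NonEmpty using (List⁺; toList)
open import Data.List.Relation.Unary.Linked using (Linked)
open import Data.Product using (∃-syntax; _×_)
open import Relation.Binary.PropositionalEquality using (_≡_)

open import Data.Nat using (zero; suc; _+_; _∸_; _≤_; _<_; _<?_; z≤n)
open import Data.Nat.Properties
  using (<-trans; ≤-trans; ≤-reflexive; <⇒≤; ≤-<-trans; <-irrefl; ≮⇒≥; m≤m+n; m≤n+m; +-suc; +-identityʳ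
        ; +-monoʳ-<; +-monoʳ-≤; ∸-monoˡ-<; ∸-monoˡ-≤; m+n∸m≡n; m≤n⇒m<n∨m≡n)
open import Data.Fin using (fromℕ<)
open import Data.Fin.Properties using (fromℕ<-toℕ; toℕ-fromℕ<; toℕ<n)
open import Data.Maybe using (Maybe; just; nothing; _>>=_)
import Data.Maybe.Relation.Unary.Any as Maybe
open import Data.List using (List; []; _∷_; map; _++_; mapMaybe)
open import Data.List.NonEmpty using (_∷_; head; fromList)
open import Data.List.Relation.Unary.All as All using (All; []; _∷_)
open import Data.List.Relation.Unary.Any using (here; there)
open import Data.List.Relation.Unary.Any.Properties using (gmap; mapMaybe⁺)
open import Data.List.Relation.Unary.Linked using ([]; [-]; _∷_)
import Data.List.Relation.Unary.Linked as Linked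
import Data.List.Relation.Unary.Linked.Properties as Linked
open import Data.List.Relation.Binary.Sublist.Propositional using (_⊆_; []; _∷_; _∷ʳ_; minimum)
open import Data.List.Membership.Propositional using (_∈_)
open import Data.List.Membership.Propositional.Properties using (∈-map⁺; ∈-++⁺ˡ; ∈-++⁺ʳ)
open import Data.Product using (_,_; proj₁; proj₂)
open import Data.Empty using (⊥-elim)
open import Data.Unit using (tt)
open import Data.Sum using (inj₁; inj₂)
import Data.List.Relation.Unary.AllPairs as AllPairs
open import Function using (_∘_)
open import Relation.Nullary using (yes; no)
open import Relation.Binary.PropositionalEquality using (refl; sym; trans; cong; cong₂; subst; subst₂)

sublists : {A : Set} → List A → List (List A)
sublists [] = [] ∷ []
sublists (x ∷ xs) = map (x ∷_) (sublists xs) ++ sublists xs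

⊆⇒∈-sublists : {A : Set} {xs ys : List A} → xs ⊆ ys → xs ∈ sublists ys
⊆⇒∈-sublists [] = here refl
⊆⇒∈-sublists {ys = y ∷ ys} (.y ∷ʳ xs⊆ys) = ∈-++⁺ʳ (map (y ∷_) (sublists ys)) (⊆⇒∈-sublists xs⊆ys)
⊆⇒∈-sublists (refl ∷ xs⊆ys) = ∈-++⁺ˡ (∈-map⁺ _ (⊆⇒∈-sublists xs⊆ys))

increasing⇒head< : ∀ {x xs} → Linked _<_ (x ∷ xs) → All (x <_) xs
increasing⇒head< = AllPairs.head ∘ Linked.Linked⇒AllPairs <-trans

range : ℕ → ℕ → List ℕ
range a zero = []
range a (suc k) = a ∷ range (suc a) k

increasing⇒⊆range : ∀ k {a xs} → Linked _<_ xs → All (a ≤_) xs → All (_< a + k) xs → xs ⊆ range a k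
increasing⇒⊆range zero {xs = []} _ _ _ = []
increasing⇒⊆range zero {a} {_ ∷ _} _ (a≤x ∷ _) (x<a+0 ∷ _) =
  ⊥-elim (<-irrefl refl (≤-<-trans a≤x (subst (_ <_) (+-identityʳ a) x<a+0)))
increasing⇒⊆range (suc k) {xs = []} _ _ _ = minimum _
increasing⇒⊆range (suc k) {a} {x ∷ xs} inc (a≤x ∷ _) below
  with m≤n⇒m<n∨m≡n a≤x | All.map (λ {t} → subst (t <_) (+-suc a k)) below
... | inj₁ a<x  | below′     =
  a ∷ʳ increasing⇒⊆range k inc (a<x ∷ All.map (≤-<-trans a≤x) (increasing⇒head< inc)) below′
... | inj₂ refl | _ ∷ below′ =
  refl ∷ increasing⇒⊆range k (Linked.tail inc) (increasing⇒head< inc) below′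

Is-just⇒≡just : {A : Set} {m : Maybe A} → Is-just m → ∃[ x ] m ≡ just x
Is-just⇒≡just (Maybe.just _) = _ , refl

∸-increasing : ∀ {n y ys} → n ≤ y → Linked _<_ (y ∷ ys) → Linked _<_ (map (_∸ n) (y ∷ ys))
∸-increasing n≤y [-] = [-]
∸-increasing n≤y (y<z ∷ inc) = ∸-monoˡ-< y<z n≤y ∷ ∸-increasing (≤-trans n≤y (<⇒≤ y<z)) inc

data SplitAt (n : ℕ) : List ℕ → Set where
  below : ∀ {x xs} → Linked _<_ (x ∷ xs) → All (_< n) (x ∷ xs) → SplitAt n (x ∷ xs)
  above : ∀ {y ys} → n ≤ y → Linked _<_ (y ∷ ys) → SplitAt n (y ∷ ys)
  straddle : ∀ {x xs y ys} → Linked _<_ (x ∷ xs) → All (_< n) (x ∷ xs) → n ≤ y → Linked _<_ (y ∷ ys)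
           → SplitAt n (x ∷ xs ++ y ∷ ys)

splitAt : ∀ n {x xs} → Linked _<_ (x ∷ xs) → SplitAt n (x ∷ xs)
splitAt n {x} inc with x <? n
... | no x≮n = above (≮⇒≥ x≮n) inc
splitAt n [-] | yes x<n = below [-] (x<n ∷ [])
splitAt n (x<y ∷ inc) | yes x<n with splitAt n inc
... | above n≤y inc′ = straddle [-] (x<n ∷ []) n≤y inc′
... | below inc′ low = below (x<y ∷ inc′) (x<n ∷ low)
... | straddle inc′ low n≤z high = straddle (x<y ∷ inc′) (x<n ∷ low) n≤z high

module PartialProducts (PS : PartialSemigroup) where
  open PartialSemigroup PS

  ⋆-assoc : ∀ a b c → _⋆_ PS (_⋆_ PS a b) c ≡ _⋆_ PS a (_⋆_ PS b c)
  ⋆-assoc nothing _ _ = refl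
  ⋆-assoc (just x) nothing _ = refl
  ⋆-assoc (just x) (just y) nothing with x · y
  ... | just _ = refl
  ... | nothing = refl
  ⋆-assoc (just x) (just y) (just z) = assoc x y z

  prodL-map : {A B : Set} (g : B → Carrier) (s : A → B)
            → ∀ x xs → prodL PS (g ∘ s) x xs ≡ prodL PS g (s x) (map s xs)
  prodL-map g s x [] = refl
  prodL-map g s x (y ∷ ys) = cong (_⋆_ PS (just (g (s x)))) (prodL-map g s y ys)

  prodL-++ : {A : Set} (g : A → Carrier) → ∀ x xs y ys
           → prodL PS g x (xs ++ y ∷ ys) ≡ _⋆_ PS (prodL PS g x xs) (prodL PS g y ys)
  prodL-++ g x [] y ys = refl
  prodL-++ g x (x′ ∷ xs) y ys = trans (cong (_⋆_ PS (just (g x))) (prodL-++ g x′ xs y ys))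
                                      (sym (⋆-assoc (just (g x)) (prodL PS g x′ xs) (prodL PS g y ys)))

  productsBelow : (ℕ → Carrier) → ℕ → List Carrier
  productsBelow g n = mapMaybe (λ H → fromList H >>= prod PS g) (sublists (range 0 n))

  ∈-productsBelow : ∀ g n {x xs p} → Linked _<_ (x ∷ xs) → All (_< n) (x ∷ xs)
                  → prodL PS g x xs ≡ just p → p ∈ productsBelow g n
  ∈-productsBelow g n {x} {xs} {p} inc low gx≡p =
    mapMaybe⁺ _ (sublists (range 0 n))
      (gmap value-is-p (⊆⇒∈-sublists (increasing⇒⊆range n inc (All.universal (λ _ → z≤n) _) low)))
    where
    value-is-p : ∀ {H} → x ∷ xs ≡ H → Maybe.Any (p ≡_) (fromList H >>= prod PS g)
    value-is-p refl = subst (Maybe.Any (p ≡_)) (sym gx≡p) (Maybe.just refl)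

  ProductsIn : (ℕ → Carrier) → List⁺ Carrier → ℕ → Set
  ProductsIn g F m = ∀ H → IncreasingFinSet PS H → m ≤ head H → ∃[ s ] (prod PS g H ≡ just s × σ PS F s)

  ProductsIn-mono : ∀ {g F m m′} → m ≤ m′ → ProductsIn g F m → ProductsIn g F m′
  ProductsIn-mono m≤m′ g-in H inc m′≤ = g-in H inc (≤-trans m≤m′ m′≤)

  ProductsIn-shift : ∀ {g F} m {m′} → ProductsIn g F (m + m′) → ProductsIn (g ∘ (m +_)) F m′
  ProductsIn-shift {g} m g-in (x ∷ xs) inc m′≤x =
    let s , g≡s , σs = g-in (m + x ∷ map (m +_) xs) (Linked.map⁺ (Linked.map (+-monoʳ-< m) inc))
                            (+-monoʳ-≤ m m′≤x)
    in s , trans (prodL-map g (m +_) x xs) g≡s , σs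

  module _ {n : ℕ} (f : Fin n → Carrier) where

    prepend : (ℕ → Carrier) → ℕ → Carrier
    prepend k t with t <? n
    ... | yes t<n = f (fromℕ< t<n)
    ... | no _ = k (t ∸ n)

    prepend-< : ∀ k {t} (t<n : t < n) → prepend k t ≡ f (fromℕ< t<n)
    prepend-< k {t} t<n with t <? n
    ... | yes _ = refl
    ... | no t≮n = ⊥-elim (t≮n t<n)

    prepend-≥ : ∀ k {t} → n ≤ t → prepend k t ≡ k (t ∸ n)
    prepend-≥ k {t} n≤t with t <? n
    ... | yes t<n = ⊥-elim (<-irrefl refl (≤-<-trans n≤t t<n))
    ... | no _ = refl

    prepend-toℕ : ∀ k i → prepend k (toℕ i) ≡ f i
    prepend-toℕ k i = trans (prepend-< k (toℕ<n i)) (cong f (fromℕ<-toℕ i (toℕ<n i)))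

    toFins : ∀ {xs} → All (_< n) xs → List (Fin n)
    toFins [] = []
    toFins (x<n ∷ low) = fromℕ< x<n ∷ toFins low

    toFins-increasing : ∀ {x xs} (x<n : x < n) (low : All (_< n) xs)
                      → Linked _<_ (x ∷ xs) → Linked Fin._<_ (fromℕ< x<n ∷ toFins low)
    toFins-increasing x<n [] [-] = [-]
    toFins-increasing x<n (y<n ∷ low) (x<y ∷ inc) =
      subst₂ _<_ (sym (toℕ-fromℕ< x<n)) (sym (toℕ-fromℕ< y<n)) x<y ∷ toFins-increasing y<n low inc

    prodL-prepend-< : ∀ k {x xs} (x<n : x < n) (low : All (_< n) xs)
                    → prodL PS (prepend k) x xs ≡ prodL PS f (fromℕ< x<n) (toFins low)
    prodL-prepend-< k x<n [] = cong just (prepend-< k x<n)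
    prodL-prepend-< k x<n (y<n ∷ low) = cong₂ (_⋆_ PS) (cong just (prepend-< k x<n)) (prodL-prepend-< k y<n low)

    prodL-prepend-≥ : ∀ k {y ys} → n ≤ y → Linked _<_ (y ∷ ys)
                    → prodL PS (prepend k) y ys ≡ prodL PS k (y ∸ n) (map (_∸ n) ys)
    prodL-prepend-≥ k n≤y [-] = cong just (prepend-≥ k n≤y)
    prodL-prepend-≥ k n≤y (y<z ∷ inc) =
      cong₂ (_⋆_ PS) (cong just (prepend-≥ k n≤y)) (prodL-prepend-≥ k (≤-trans n≤y (<⇒≤ y<z)) inc)

    prodL-prepend-tail-irrelevant : ∀ k k′ {x xs} → All (_< n) (x ∷ xs)
                                  → prodL PS (prepend k) x xs ≡ prodL PS (prepend k′) x xs
    prodL-prepend-tail-irrelevant k k′ (x<n ∷ low) =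
      trans (prodL-prepend-< k x<n low) (sym (prodL-prepend-< k′ x<n low))

    ProductsIn-prepend : ∀ {k F m} → ProductsIn k F m → ProductsIn (prepend k) F (n + m)
    ProductsIn-prepend {k} {F} {m} k-in (y ∷ ys) inc n+m≤y =
      let s , k≡s , σs = k-in (y ∸ n ∷ map (_∸ n) ys) (∸-increasing n≤y inc) m≤y∸n
      in s , trans (prodL-prepend-≥ k n≤y inc) k≡s , σs
      where
      n≤y : n ≤ y
      n≤y = ≤-trans (m≤m+n n m) n+m≤y
      m≤y∸n : m ≤ y ∸ n
      m≤y∸n = subst (_≤ y ∸ n) (m+n∸m≡n n m) (∸-monoˡ-≤ n n+m≤y)

    prepend-defined : ∀ {k F}
      → (∀ (H : List⁺ (Fin n)) → Linked Fin._<_ (toList H) → Is-just (prod PS f H))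
      → (∀ {x xs p} → Linked _<_ (x ∷ xs) → All (_< n) (x ∷ xs)
           → prodL PS (prepend k) x xs ≡ just p → p ∈ toList F)
      → ProductsIn k F 0
      → ∀ H → IncreasingFinSet PS H → Is-just (prod PS (prepend k) H)
    prepend-defined {k} {F} f-defined low∈F k-in (x ∷ xs) inc = split-defined (splitAt n inc)
      where
      g-in : ProductsIn (prepend k) F n
      g-in = ProductsIn-mono (≤-reflexive (+-identityʳ n)) (ProductsIn-prepend k-in)

      below-defined : ∀ {x xs} → Linked _<_ (x ∷ xs) → All (_< n) (x ∷ xs)
                    → Is-just (prodL PS (prepend k) x xs)
      below-defined inc (x<n ∷ low) =
        subst Is-just (sym (prodL-prepend-< k x<n low))
              (f-defined (fromℕ< x<n ∷ toFins low) (toFins-increasing x<n low inc))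

      split-defined : ∀ {x xs} → SplitAt n (x ∷ xs) → Is-just (prodL PS (prepend k) x xs)
      split-defined (below inc low) = below-defined inc low
      split-defined (above {y} {ys} n≤y inc) =
        let _ , g≡s , _ = g-in (y ∷ ys) inc n≤y
        in subst Is-just (sym g≡s) (Maybe.just tt)
      split-defined (straddle {x} {ks} {y} {ys} incₗ low n≤y incₕ) =
        let p , gₗ≡p = Is-just⇒≡just (below-defined incₗ low)
            s , gₕ≡s , σs = g-in (y ∷ ys) incₕ n≤y
        in subst Is-just (sym (trans (prodL-++ (prepend k) x ks y ys) (cong₂ (_⋆_ PS) gₗ≡p gₕ≡s)))
                 (All.lookup σs (low∈F incₗ low gₗ≡p))

theorem5p2 : (PS : PartialSemigroup) → Adequate PS → (n : ℕ)
    → (f : Fin n → PartialSemigroup.Carrier PS)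
    → (∀ (H : List⁺ (Fin n)) → Linked Fin._<_ (toList H) → Is-just (prod PS f H))
    → 𝒯-nonempty PS
    → ∃[ g ] (AdequateSeq PS g × (∀ (i : Fin n) → g (toℕ i) ≡ f i))
theorem5p2 PS _ n f f-defined (h , _ , h-adequate) = g , (g-defined , g-adequate) , prepend-toℕ f k
  where
  open PartialSemigroup PS using (Carrier)
  open PartialProducts PS

  -- h 0 only makes F nonempty. Products of prepend f k below n do not depend on the tail k,
  -- which is what allows F to be fixed (with tail h) before m is chosen.
  F : List⁺ Carrier
  F = h 0 ∷ productsBelow (prepend f h) n

  m : ℕ
  m = proj₁ (h-adequate F)

  k : ℕ → Carrier
  k = h ∘ (m +_)

  g : ℕ → Carrier
  g = prepend f k

  k-in-F : ProductsIn k F 0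
  k-in-F = ProductsIn-shift m (ProductsIn-mono (m≤m+n m 0) (proj₂ (h-adequate F)))

  low∈F : ∀ {x xs p} → Linked _<_ (x ∷ xs) → All (_< n) (x ∷ xs) → prodL PS g x xs ≡ just p → p ∈ toList F
  low∈F inc low g≡p =
    there (∈-productsBelow (prepend f h) n inc low (trans (prodL-prepend-tail-irrelevant f h k low) g≡p))

  g-defined : ∀ H → IncreasingFinSet PS H → Is-just (prod PS g H)
  g-defined = prepend-defined f f-defined low∈F k-in-F

  g-adequate : ∀ F′ → ∃[ m′ ] ProductsIn g F′ m′
  g-adequate F′ = let m′ , h-in = h-adequate F′
                  in n + m′ , ProductsIn-prepend f (ProductsIn-shift m (ProductsIn-mono (m≤n+m m′ m) h-in))
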